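{- For $n\ge1$ let $C_n(y)=\sum_{k=0}^{n-1}y^{\,n-k-1}T(n-1,k)$, where $T(m,k)=\frac{(m+k)!}{(m-k)!\,k!}$. Then for all $n\ge3$, $$C_n(y)=(4n-6)\,C_{n-1}(y)+y^{2}\,C_{n-2}(y).$$ -}

module Defs where

open import Level using (Level)
open import Data.Nat using (ℕ; zero; suc; _!)
import Data.Nat as ℕ
open import Data.Nat.Properties using (_!*_!≢0)
open import Algebra.Bundles using (CommutativeSemiring)

-- T(m,k) = (m+k)! / ((m-k)! k!)   (exact natural-number division; used for k ≤ m)
T : ℕ → ℕ → ℕ
T m k = ((m ℕ.+ k) !) ℕ./ (((m ℕ.∸ k) !) ℕ.* (k !)) where instance _ = (m ℕ.∸ k) !* k !≢0

module _ {c ℓ : Level} (R : CommutativeSemiring c ℓ) where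
  open CommutativeSemiring R
  open import Algebra.Definitions.RawSemiring rawSemiring public using (_×_; _^_)

  sumTo : ℕ → (ℕ → Carrier) → Carrier
  sumTo zero    f = 0#
  sumTo (suc n) f = sumTo n f + f n

  -- C_n(y) = Σ_{k=0}^{n-1} y^(n-k-1) T(n-1,k)   (meaningful for n ≥ 1)
  -- natural-number coefficients act via the semiring's ℕ-scaling _×_
  C : ℕ → Carrier → Carrier
  C n y = sumTo n (λ k → T (n ℕ.∸ 1) k × (y ^ (n ℕ.∸ k ℕ.∸ 1)))

-- Comparing coefficients of powers of y, the recurrence amounts to
--   T(N+2, 0) = T(N, 0) = 1,   T(N+2, k+1) = (4N+6) T(N+1, k) + T(N, k+1)  for k < N,
-- and the two boundary cases k = N, N+1, in which the last term is absent (there T(N, k+1)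
-- would be a junk value of the truncated subtraction in T). Clearing the factorial
-- denominators turns each of these into the polynomial identity
--   (N+k+3)(N+k+2) = (4N+6)(k+1) + (N+1-k)(N-k).
module Submission where

open import Level using (Level)
open import Algebra.Bundles using (CommutativeSemiring)
open import Defs using (T; sumTo; C)

module TRecurrence where
  open import Data.Nat
  open import Data.Nat.Properties
  open import Data.Nat.Divisibility using (∣-trans; m≤n⇒m!∣n!)
  open import Data.Nat.DivMod using (m/n*n≡m)
  open import Data.Nat.Combinatorics using ([n∸k]!k!∣n!)
  open import Data.Nat.Tactic.RingSolver using (solve-∀)
  open import Data.Product using (_,_)
  open import Relation.Binary.PropositionalEquality
  open ≡-Reasoning

  T-spec : ∀ {m k} → k ≤ m → T m k * ((m ∸ k) ! * k !) ≡ (m + k) !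
  T-spec {m} {k} k≤m =
    m/n*n≡m {{(m ∸ k) !* k !≢0}} (∣-trans ([n∸k]!k!∣n! k≤m) (m≤n⇒m!∣n! (m≤m+n m k)))

  T-factorial : ∀ {m} k j → m ≡ k + j → T m k * (j ! * k !) ≡ (m + k) !
  T-factorial k j refl = begin
    T (k + j) k * (j ! * k !)                ≡⟨ cong (λ i → T (k + j) k * (i ! * k !)) (m+n∸m≡n k j) ⟨
    T (k + j) k * ((k + j ∸ k) ! * k !)      ≡⟨ T-spec (m≤m+n k j) ⟩
    (k + j + k) !                            ∎

  T-unique : ∀ {m} k j x → m ≡ k + j → x * (j ! * k !) ≡ (m + k) ! → T m k ≡ x
  T-unique k j x m≡k+j eq =
    *-cancelʳ-≡ _ x (j ! * k !) {{j !* k !≢0}} (trans (T-factorial k j m≡k+j) (sym eq))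

  T-zero : ∀ m → T m 0 ≡ 1
  T-zero m = T-unique 0 m 1 refl (begin
    m ! * 1 + 0   ≡⟨ trans (+-identityʳ _) (*-identityʳ _) ⟩
    m !           ≡⟨ cong _! (+-identityʳ m) ⟨
    (m + 0) !     ∎)

  T-recurrence : ∀ {N k} → k < N → T (2 + N) (suc k) ≡ (4 * N + 6) * T (suc N) k + T N (suc k)
  T-recurrence {k = k} k<N with m≤n⇒∃[o]m+o≡n k<N
  ... | j , refl = T-unique (suc k) (2 + j) _ (cong suc (sym k+[2+j])) (begin
      (Q * a + b) * ((2 + j) ! * (1 + k) !)
    ≡⟨ regroup Q a b j k (j !) (k !) ⟩
      (1 + k) * Q * (a * ((2 + j) ! * k !)) + (2 + j) * (1 + j) * (b * (j ! * (1 + k) !))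
    ≡⟨ cong₂ (λ u v → (1 + k) * Q * u + (2 + j) * (1 + j) * v)
             (T-factorial k (2 + j) (sym k+[2+j]))
             (trans (T-factorial (suc k) j refl) (cong (λ i → suc i !) (+-suc (k + j) k))) ⟩
      (1 + k) * Q * (2 + G) ! + (2 + j) * (1 + j) * (2 + G) !
    ≡⟨ factorial-step k j ((2 + G) !) ⟩
      (4 + G) !
    ≡⟨ cong (λ i → (3 + i) !) (+-suc (k + j) k) ⟨
      (3 + k + j + suc k) !
    ∎)
    where
    G = k + j + k
    Q = 4 * (1 + k + j) + 6
    a = T (2 + k + j) k
    b = T (1 + k + j) (suc k)
    k+[2+j] : k + (2 + j) ≡ 2 + (k + j)
    k+[2+j] = trans (+-suc k (suc j)) (cong suc (+-suc k j))
    regroup : ∀ q a b j k J K →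
      (q * a + b) * ((2 + j) * ((1 + j) * J) * ((1 + k) * K))
        ≡ (1 + k) * q * (a * ((2 + j) * ((1 + j) * J) * K)) + (2 + j) * (1 + j) * (b * (J * ((1 + k) * K)))
    regroup = solve-∀
    factorial-step : ∀ k j g →
      (1 + k) * (4 * (1 + k + j) + 6) * g + (2 + j) * (1 + j) * g
        ≡ (4 + (k + j + k)) * ((3 + (k + j + k)) * g)
    factorial-step = solve-∀

  move-factor : ∀ q a n F → q * a * (1 * (n * F)) ≡ q * n * (a * (1 * F))
  move-factor = solve-∀

  T-recurrence-subdiagonal : ∀ N → T (2 + N) (suc N) ≡ (4 * N + 6) * T (suc N) N
  T-recurrence-subdiagonal N = T-unique (suc N) 1 _ (sym (+-comm (suc N) 1)) (begin
      Q * a * (1 ! * (1 + N) !)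
    ≡⟨ move-factor Q a (1 + N) (N !) ⟩
      Q * (1 + N) * (a * (1 ! * N !))
    ≡⟨ cong (Q * (1 + N) *_) (T-factorial N 1 (sym (+-comm N 1))) ⟩
      Q * (1 + N) * (1 + N + N) !
    ≡⟨ factorial-step N ((1 + N + N) !) ⟩
      (3 + (N + N)) !
    ≡⟨ cong (λ i → (2 + i) !) (+-suc N N) ⟨
      (2 + N + suc N) !
    ∎)
    where
    Q = 4 * N + 6
    a = T (suc N) N
    factorial-step : ∀ n g → (4 * n + 6) * (1 + n) * g ≡ (3 + (n + n)) * ((2 + (n + n)) * g)
    factorial-step = solve-∀

  T-recurrence-diagonal : ∀ N → T (2 + N) (2 + N) ≡ (4 * N + 6) * T (suc N) (suc N)
  T-recurrence-diagonal N = T-unique (2 + N) 0 _ (sym (+-identityʳ _)) (begin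
      Q * a * (0 ! * (2 + N) !)
    ≡⟨ move-factor Q a (2 + N) ((1 + N) !) ⟩
      Q * (2 + N) * (a * (0 ! * (1 + N) !))
    ≡⟨ cong (Q * (2 + N) *_) (T-factorial (suc N) 0 (sym (+-identityʳ _))) ⟩
      Q * (2 + N) * (1 + N + (1 + N)) !
    ≡⟨ cong (λ i → Q * (2 + N) * suc i !) (+-suc N N) ⟩
      Q * (2 + N) * (2 + (N + N)) !
    ≡⟨ factorial-step N ((2 + (N + N)) !) ⟩
      (4 + (N + N)) !
    ≡⟨ cong (λ i → (2 + i) !) N+[2+N] ⟨
      (2 + N + (2 + N)) !
    ∎)
    where
    Q = 4 * N + 6
    a = T (suc N) (suc N)
    N+[2+N] : N + (2 + N) ≡ 2 + (N + N)
    N+[2+N] = trans (+-suc N (suc N)) (cong suc (+-suc N N))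
    factorial-step : ∀ n g → (4 * n + 6) * (2 + n) * g ≡ (4 + (n + n)) * ((3 + (n + n)) * g)
    factorial-step = solve-∀

  4*[3+n]∸6≡4*n+6 : ∀ n → 4 * (3 + n) ∸ 6 ≡ 4 * n + 6
  4*[3+n]∸6≡4*n+6 n = trans (cong (_∸ 6) (expand n)) (m+n∸m≡n 6 (4 * n + 6))
    where
    expand : ∀ n → 4 * (3 + n) ≡ 6 + (4 * n + 6)
    expand = solve-∀

  [1+m]∸n∸1≡m∸n : ∀ m n → suc m ∸ n ∸ 1 ≡ m ∸ n
  [1+m]∸n∸1≡m∸n m zero    = refl
  [1+m]∸n∸1≡m∸n m (suc n) = trans (∸-+-assoc m n 1) (cong (m ∸_) (+-comm n 1))

module CRecurrence {c ℓ : Level} (R : CommutativeSemiring c ℓ) where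
  open CommutativeSemiring R
  open import Algebra.Definitions.RawSemiring rawSemiring using (_×_; _^_)
  open import Algebra.Properties.Monoid.Mult +-monoid using (×-congʳ; ×-congˡ; ×-homo-1; ×-homo-+; ×-assocˡ)
  open import Algebra.Properties.CommutativeMonoid.Mult +-commutativeMonoid using (×-distrib-+)
  open import Algebra.Properties.Semiring.Mult semiring using (×-comm-*)
  open import Algebra.Properties.Semiring.Exp semiring using (^-congʳ; ^-homo-*)
  open import Algebra.Properties.CommutativeSemigroup +-commutativeSemigroup using (xy∙z≈xz∙y; interchange)
  open import Data.Nat as ℕ using (ℕ; zero; suc; _<_; _∸_)
  open import Data.Nat.Properties using (n<1+n; m<n⇒m<1+n; +-∸-assoc)
  import Relation.Binary.PropositionalEquality as ≡
  open import Relation.Binary.Reasoning.Setoid setoid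
  open TRecurrence

  sumTo-cong : ∀ n {f g : ℕ → Carrier} → (∀ k → f k ≈ g k) → sumTo R n f ≈ sumTo R n g
  sumTo-cong zero    f≈g = refl
  sumTo-cong (suc n) f≈g = +-cong (sumTo-cong n f≈g) (f≈g n)

  ×-distrib-sumTo : ∀ q n (f : ℕ → Carrier) → q × sumTo R n f ≈ sumTo R n (λ k → q × f k)
  ×-distrib-sumTo q zero    f = begin
    q × 0#            ≈⟨ ×-congʳ q (zeroˡ 0#) ⟨
    q × (0# * 0#)     ≈⟨ ×-comm-* q 0# 0# ⟨
    0# * (q × 0#)     ≈⟨ zeroˡ _ ⟩
    0#                ∎
  ×-distrib-sumTo q (suc n) f = trans (×-distrib-+ (sumTo R n f) (f n) q) (+-congʳ (×-distrib-sumTo q n f))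

  *-distribˡ-sumTo : ∀ x n (f : ℕ → Carrier) → x * sumTo R n f ≈ sumTo R n (λ k → x * f k)
  *-distribˡ-sumTo x zero    f = zeroʳ x
  *-distribˡ-sumTo x (suc n) f = trans (distribˡ x (sumTo R n f) (f n)) (+-congʳ (*-distribˡ-sumTo x n f))

  sumTo-split : ∀ n (f g h : ℕ → Carrier) → f 0 ≈ h 0 → (∀ k → k < n → f (suc k) ≈ g k + h (suc k)) →
                sumTo R (suc n) f ≈ sumTo R n g + sumTo R (suc n) h
  sumTo-split zero    f g h f₀≈h₀ _  = trans (+-congˡ f₀≈h₀) (sym (+-identityˡ _))
  sumTo-split (suc n) f g h f₀≈h₀ fs≈ = begin
      sumTo R (suc n) f + f (suc n)
    ≈⟨ +-cong (sumTo-split n f g h f₀≈h₀ (λ k k<n → fs≈ k (m<n⇒m<1+n k<n))) (fs≈ n (n<1+n n)) ⟩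
      (sumTo R n g + sumTo R (suc n) h) + (g n + h (suc n))
    ≈⟨ interchange _ _ _ _ ⟩
      (sumTo R n g + g n) + (sumTo R (suc n) h + h (suc n))
    ∎

  module _ (y : Carrier) where

    term : ℕ → ℕ → Carrier
    term m k = T m k × (y ^ (m ∸ k))

    C≈sumTo-term : ∀ m → C R (suc m) y ≈ sumTo R (suc m) (term m)
    C≈sumTo-term m = sumTo-cong (suc m) (λ k → ×-congʳ (T m k) (^-congʳ y ([1+m]∸n∸1≡m∸n m k)))

    term-zero : ∀ N → term (2 ℕ.+ N) 0 ≈ y ^ 2 * term N 0
    term-zero N = begin
      T (2 ℕ.+ N) 0 × (y ^ (2 ℕ.+ N))   ≈⟨ ×-congˡ (T-zero (2 ℕ.+ N)) ⟩
      1 × (y ^ (2 ℕ.+ N))               ≈⟨ ×-homo-1 _ ⟩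
      y ^ (2 ℕ.+ N)                     ≈⟨ ^-homo-* y 2 N ⟩
      y ^ 2 * y ^ N                     ≈⟨ *-congˡ (×-homo-1 _) ⟨
      y ^ 2 * (1 × (y ^ N))             ≈⟨ *-congˡ (×-congˡ (T-zero N)) ⟨
      y ^ 2 * term N 0                  ∎

    term-scale : ∀ N k q → T (2 ℕ.+ N) (suc k) ≡.≡ q ℕ.* T (suc N) k →
                 term (2 ℕ.+ N) (suc k) ≈ q × term (suc N) k
    term-scale N k q T≡ = trans (×-congˡ T≡) (sym (×-assocˡ (y ^ (suc N ∸ k)) q (T (suc N) k)))

    term-recurrence : ∀ {N k} → k < N →
                      term (2 ℕ.+ N) (suc k) ≈ (4 ℕ.* N ℕ.+ 6) × term (suc N) k + y ^ 2 * term N (suc k)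
    term-recurrence {N} {k} k<N = begin
        T (2 ℕ.+ N) (suc k) × z
      ≈⟨ ×-congˡ (T-recurrence k<N) ⟩
        (Q ℕ.* a ℕ.+ b) × z
      ≈⟨ ×-homo-+ z (Q ℕ.* a) b ⟩
        (Q ℕ.* a) × z + b × z
      ≈⟨ +-cong (sym (×-assocˡ z Q a)) (×-congʳ b (^-congʳ y (+-∸-assoc 2 k<N))) ⟩
        Q × term (suc N) k + b × (y ^ (2 ℕ.+ (N ∸ suc k)))
      ≈⟨ +-congˡ (×-congʳ b (^-homo-* y 2 (N ∸ suc k))) ⟩
        Q × term (suc N) k + b × (y ^ 2 * y ^ (N ∸ suc k))
      ≈⟨ +-congˡ (×-comm-* b (y ^ 2) (y ^ (N ∸ suc k))) ⟨
        Q × term (suc N) k + y ^ 2 * term N (suc k)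
      ∎
      where
      Q = 4 ℕ.* N ℕ.+ 6
      a = T (suc N) k
      b = T N (suc k)
      z = y ^ (suc N ∸ k)

    C-recurrence : ∀ N → C R (3 ℕ.+ N) y ≈ (4 ℕ.* N ℕ.+ 6) × C R (2 ℕ.+ N) y + y ^ 2 * C R (suc N) y
    C-recurrence N = begin
        C R (3 ℕ.+ N) y
      ≈⟨ C≈sumTo-term (2 ℕ.+ N) ⟩
        (sumTo R (suc N) (term (2 ℕ.+ N)) + term (2 ℕ.+ N) (suc N)) + term (2 ℕ.+ N) (2 ℕ.+ N)
      ≈⟨ +-cong (+-cong (sumTo-split N (term (2 ℕ.+ N)) g h (term-zero N) (λ k → term-recurrence))
                        (term-scale N N Q (T-recurrence-subdiagonal N)))
                (term-scale N (suc N) Q (T-recurrence-diagonal N)) ⟩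
        ((sumTo R N g + sumTo R (suc N) h) + g N) + g (suc N)
      ≈⟨ trans (+-congʳ (xy∙z≈xz∙y _ _ _)) (xy∙z≈xz∙y _ _ _) ⟩
        sumTo R (2 ℕ.+ N) g + sumTo R (suc N) h
      ≈⟨ +-cong (×-distrib-sumTo Q (2 ℕ.+ N) (term (suc N))) (*-distribˡ-sumTo (y ^ 2) (suc N) (term N)) ⟨
        Q × sumTo R (2 ℕ.+ N) (term (suc N)) + y ^ 2 * sumTo R (suc N) (term N)
      ≈⟨ +-cong (×-congʳ Q (C≈sumTo-term (suc N))) (*-congˡ (C≈sumTo-term N)) ⟨
        Q × C R (2 ℕ.+ N) y + y ^ 2 * C R (suc N) y
      ∎
      where
      Q = 4 ℕ.* N ℕ.+ 6
      g h : ℕ → Carrier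
      g k = Q × term (suc N) k
      h k = y ^ 2 * term N k

open import Data.Nat using (ℕ; _≤_; _∸_; _*_; suc; s≤s)
open import Defs using (_×_; _^_)

proposition8p18 : ∀ {c ℓ : Level} (R : CommutativeSemiring c ℓ) (n : ℕ) → 3 ≤ n →
    (y : CommutativeSemiring.Carrier R) →
    CommutativeSemiring._≈_ R (C R n y)
      (CommutativeSemiring._+_ R
        (_×_ R (4 * n ∸ 6) (C R (n ∸ 1) y))
        (CommutativeSemiring._*_ R (_^_ R y 2) (C R (n ∸ 2) y)))
proposition8p18 R (suc (suc (suc N))) (s≤s (s≤s (s≤s _))) y =
  trans (CRecurrence.C-recurrence R y N) (+-congʳ (×-congˡ (≡.sym (TRecurrence.4*[3+n]∸6≡4*n+6 N))))
  where
  open CommutativeSemiring R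
  open import Algebra.Properties.Monoid.Mult +-monoid using (×-congˡ)
  import Relation.Binary.PropositionalEquality as ≡
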